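{- Let $\sigma$ be the morphism on $\{0,1,2\}^*$ defined by $\sigma(0)=01$, $\sigma(1)=12$, $\sigma(2)=20$, and let $\mathbf{t}=\sigma^{\infty}(0)$ be its fixed point starting with $0$. Let $n\geq 1$ be an integer and let $u$ be a factor of $\mathbf{t}$ of length $n$. Then: (1) there exists a factor $x$ of $\mathbf{t}$ of length $\lfloor n/2\rfloor$ such that $|x|_1-|x|_0-1\leq |u|_2-|u|_0\leq |x|_1-|x|_0+1$; (2) there exists a factor $y$ of $\mathbf{t}$ of length $\lfloor n/2\rfloor$ such that $|y|_1-|y|_2-1\leq |u|_1-|u|_0\leq |y|_1-|y|_2+1$; (3) there exists a factor $z$ of $\mathbf{t}$ of length $\lfloor n/2\rfloor$ such that $|z|_0-|z|_2-1\leq |u|_1-|u|_2\leq |z|_0-|z|_2+1$.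
   Context: $|w|_a$ denotes the number of occurrences of the letter $a$ in the word $w$. The only factor of length $0$ is the empty word. -}

module Defs where

open import Data.Nat using (ℕ; zero; suc; _+_)
open import Data.Integer using (ℤ; +_; _-_)
open import Data.List using (List; []; _∷_; concatMap; length; map; upTo)
open import Data.Product using (∃; _×_)
open import Relation.Binary.PropositionalEquality using (_≡_)

data Letter : Set where
  a0 a1 a2 : Letter

σ : Letter → List Letter
σ a0 = a0 ∷ a1 ∷ []
σ a1 = a1 ∷ a2 ∷ []
σ a2 = a2 ∷ a0 ∷ []

σ* : List Letter → List Letter
σ* = concatMap σ

σ^[_]0 : ℕ → List Letter
σ^[ zero ]0 = a0 ∷ []
σ^[ suc m ]0 = σ* σ^[ m ]0

-- the fixed point t = σ^∞(0): t[k] is the k-th letter of σ^(k+1)(0),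
-- which has length 2^(k+1) > k and is a prefix of t (σ(0) starts with 0).
-- k-th letter of a word (default a0 if out of range; never used out of range below)
at : List Letter → ℕ → Letter
at [] _ = a0
at (x ∷ w) zero = x
at (x ∷ w) (suc k) = at w k

t : ℕ → Letter
t k = at σ^[ suc k ]0 k

factorAt : ℕ → ℕ → List Letter
factorAt i n = map (λ j → t (i + j)) (upTo n)

IsFactor : ℕ → List Letter → Set
IsFactor n w = ∃ λ i → factorAt i n ≡ w

isLetter : Letter → Letter → ℕ
isLetter a0 a0 = 1
isLetter a1 a1 = 1
isLetter a2 a2 = 1
isLetter _  _  = 0

∣_∣[_] : List Letter → Letter → ℕ
∣ [] ∣[ a ] = 0
∣ x ∷ w ∣[ a ] = isLetter a x + ∣ w ∣[ a ]

diff : List Letter → Letter → Letter → ℤ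
diff w a b = + ∣ w ∣[ a ] - + ∣ w ∣[ b ]

module Submission where

-- Let next be the cyclic successor 0 ↦ 1 ↦ 2 ↦ 0, so that
-- σ(a) = a · next(a).  The fixed point is self-similar: t(2q) = t(q) and
-- t(2q+1) = next(t(q)); hence the factor of length 2k at position 2m is σ(x),
-- where x is the factor of length k at position m.  Count differences are
-- additive letter weights, and a weight f transfers along σ to the weight
-- g(a) = f(a) + f(next a), i.e. f(σ(x)) = g(x).  Writing i = 2m + r and
-- n = 2k + s with r, s ∈ {0,1}, the factor u of length n at position i is σ(x)
-- up to one letter at either end, so f(u) is within 1 of g(x) for a factor x of
-- length k = ⌊n/2⌋, provided the weights of single letters and the relevant
-- boundary corrections lie in [-1,1].  Call such a pair (f, g) admissible.

open import Defs
open import Data.Nat as ℕ using (ℕ; zero; suc; _≥_; _/_; _%_; _<_; z≤n; s≤s)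
import Data.Nat.Properties as ℕₚ
open import Data.Nat.DivMod using (m≡m%n+[m/n]*n; m%n<n)
open import Data.Integer using (ℤ; _≤_; _+_; _-_; 1ℤ; 0ℤ; -1ℤ; +_; -≤+; +≤+)
import Data.Integer.Properties as ℤₚ
open import Data.Integer.Tactic.RingSolver using (solve-∀)
open import Data.List using (List; []; _∷_; _++_; length; applyUpTo)
open import Data.List.Properties using (concatMap-++; map-applyUpTo)
open import Data.Product using (∃; _×_; _,_)
open import Data.Sum using (_⊎_; inj₁; inj₂)
open import Relation.Nullary.Decidable using (Dec; yes; no; True; toWitness; _×-dec_; _⊎-dec_)
open import Relation.Binary.PropositionalEquality
open ≡-Reasoning

-- (1) Self-similarity of the fixed point

next : Letter → Letter
next a0 = a1
next a1 = a2
next a2 = a0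

σ*-cons : ∀ y w → σ* (y ∷ w) ≡ y ∷ next y ∷ σ* w
σ*-cons a0 w = refl
σ*-cons a1 w = refl
σ*-cons a2 w = refl

_⊑_ : List Letter → List Letter → Set
w ⊑ v = ∃ λ r → v ≡ w ++ r

-- σ is a monoid morphism, hence preserves prefixes.
σ*-mono : ∀ {w v} → w ⊑ v → σ* w ⊑ σ* v
σ*-mono {w} (r , refl) = σ* r , concatMap-++ σ w r

σ^-head : ∀ m → (a0 ∷ []) ⊑ σ^[ m ]0
σ^-head zero = [] , refl
σ^-head (suc m) with σ*-mono (σ^-head m)
... | r , e = a1 ∷ r , e

σ^-mono : ∀ {m m'} → m ℕ.≤ m' → σ^[ m ]0 ⊑ σ^[ m' ]0
σ^-mono {m' = m'} z≤n = σ^-head m'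
σ^-mono (s≤s m≤m') = σ*-mono (σ^-mono m≤m')

at-⊑ : ∀ {w v} k → w ⊑ v → k < length w → at v k ≡ at w k
at-⊑ {x ∷ w} zero (r , refl) _ = refl
at-⊑ {x ∷ w} (suc k) (r , refl) (s≤s k<∣w∣) = at-⊑ {w} k (r , refl) k<∣w∣

at-σ*-even : ∀ w q → at (σ* w) (q ℕ.* 2) ≡ at w q
at-σ*-even [] q = refl
at-σ*-even (y ∷ w) zero rewrite σ*-cons y w = refl
at-σ*-even (y ∷ w) (suc q) rewrite σ*-cons y w = at-σ*-even w q

at-σ*-odd : ∀ w q → q < length w → at (σ* w) (suc (q ℕ.* 2)) ≡ next (at w q)
at-σ*-odd (y ∷ w) zero _ rewrite σ*-cons y w = refl
at-σ*-odd (y ∷ w) (suc q) (s≤s q<∣w∣) rewrite σ*-cons y w = at-σ*-odd w q q<∣w∣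

σ*-bound : ∀ w q → q < length w → suc (q ℕ.* 2) < length (σ* w)
σ*-bound (y ∷ w) zero _ rewrite σ*-cons y w = s≤s (s≤s z≤n)
σ*-bound (y ∷ w) (suc q) (s≤s q<∣w∣) rewrite σ*-cons y w = s≤s (s≤s (σ*-bound w q q<∣w∣))

σ^-long : ∀ k → k < length σ^[ suc k ]0
σ^-long zero = s≤s z≤n
σ^-long (suc k) =
  ℕₚ.≤-<-trans (s≤s (ℕₚ.m≤m*n k 2)) (σ*-bound σ^[ suc k ]0 k (σ^-long k))

at-σ^ : ∀ m k → k < length σ^[ m ]0 → at σ^[ m ]0 k ≡ t k
at-σ^ m k k<∣σ^m∣ with ℕₚ.≤-total m (suc k)
... | inj₁ m≤ = sym (at-⊑ k (σ^-mono m≤) k<∣σ^m∣)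
... | inj₂ ≤m = at-⊑ k (σ^-mono ≤m) (σ^-long k)

t-even : ∀ q → t (q ℕ.* 2) ≡ t q
t-even q = begin
  t (q ℕ.* 2)                       ≡⟨ sym (at-σ^ (suc (suc q)) (q ℕ.* 2) bound) ⟩
  at (σ* σ^[ suc q ]0) (q ℕ.* 2)   ≡⟨ at-σ*-even σ^[ suc q ]0 q ⟩
  t q                               ∎
  where
  bound : q ℕ.* 2 < length σ^[ suc (suc q) ]0
  bound = ℕₚ.<-trans (ℕₚ.n<1+n _) (σ*-bound σ^[ suc q ]0 q (σ^-long q))

t-odd : ∀ q → t (suc (q ℕ.* 2)) ≡ next (t q)
t-odd q = begin
  t (suc (q ℕ.* 2))                      ≡⟨ sym (at-σ^ (suc (suc q)) _ bound) ⟩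
  at (σ* σ^[ suc q ]0) (suc (q ℕ.* 2))  ≡⟨ at-σ*-odd σ^[ suc q ]0 q (σ^-long q) ⟩
  next (t q)                             ∎
  where
  bound : suc (q ℕ.* 2) < length σ^[ suc (suc q) ]0
  bound = σ*-bound σ^[ suc q ]0 q (σ^-long q)

-- (2) Factors and their σ-decompositions

factor : ℕ → ℕ → List Letter
factor i zero = []
factor i (suc n) = t i ∷ factor (suc i) n

applyUpTo-factor : ∀ (f : ℕ → Letter) i n → (∀ j → f j ≡ t (i ℕ.+ j)) →
  applyUpTo f n ≡ factor i n
applyUpTo-factor f i zero _ = refl
applyUpTo-factor f i (suc n) f≗ = cong₂ _∷_
  (trans (f≗ 0) (cong t (ℕₚ.+-identityʳ i)))
  (applyUpTo-factor (λ j → f (suc j)) (suc i) n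
    (λ j → trans (f≗ (suc j)) (cong t (ℕₚ.+-suc i j))))

factorAt≡factor : ∀ i n → factorAt i n ≡ factor i n
factorAt≡factor i n =
  trans (map-applyUpTo (λ j → j) (λ j → t (i ℕ.+ j)) n)
        (applyUpTo-factor _ i n (λ _ → refl))

factor-isFactor : ∀ m k → IsFactor k (factor m k)
factor-isFactor m k = m , factorAt≡factor m k

factor-snoc : ∀ i n → factor i (suc n) ≡ factor i n ++ t (i ℕ.+ n) ∷ []
factor-snoc i zero = cong (λ j → t j ∷ []) (sym (ℕₚ.+-identityʳ i))
factor-snoc i (suc n) = cong (t i ∷_) (begin
  factor (suc i) (suc n)                 ≡⟨ factor-snoc (suc i) n ⟩
  factor (suc i) n ++ t (suc i ℕ.+ n) ∷ []
    ≡⟨ cong (λ j → factor (suc i) n ++ t j ∷ []) (sym (ℕₚ.+-suc i n)) ⟩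
  factor (suc i) n ++ t (i ℕ.+ suc n) ∷ [] ∎)

factor-σ : ∀ m k → factor (m ℕ.* 2) (k ℕ.* 2) ≡ σ* (factor m k)
factor-σ m zero = refl
factor-σ m (suc k) = begin
  t (m ℕ.* 2) ∷ t (suc (m ℕ.* 2)) ∷ factor (suc m ℕ.* 2) (k ℕ.* 2)
    ≡⟨ cong₂ (λ a b → a ∷ b ∷ factor (suc m ℕ.* 2) (k ℕ.* 2)) (t-even m) (t-odd m) ⟩
  t m ∷ next (t m) ∷ factor (suc m ℕ.* 2) (k ℕ.* 2)
    ≡⟨ cong (λ w → t m ∷ next (t m) ∷ w) (factor-σ (suc m) k) ⟩
  t m ∷ next (t m) ∷ σ* (factor (suc m) k)
    ≡⟨ sym (σ*-cons (t m) (factor (suc m) k)) ⟩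
  σ* (factor m (suc k)) ∎

t-even-+ : ∀ m k → t (m ℕ.* 2 ℕ.+ k ℕ.* 2) ≡ t (m ℕ.+ k)
t-even-+ m k = trans (cong t (sym (ℕₚ.*-distribʳ-+ 2 m k))) (t-even (m ℕ.+ k))

t-odd-+ : ∀ m k → t (suc (m ℕ.* 2 ℕ.+ k ℕ.* 2)) ≡ next (t (m ℕ.+ k))
t-odd-+ m k = trans (cong (λ j → t (suc j)) (sym (ℕₚ.*-distribʳ-+ 2 m k))) (t-odd (m ℕ.+ k))

factor-even-odd : ∀ m k →
  factor (m ℕ.* 2) (suc (k ℕ.* 2)) ≡ σ* (factor m k) ++ t (m ℕ.+ k) ∷ []
factor-even-odd m k = trans (factor-snoc (m ℕ.* 2) (k ℕ.* 2))
  (cong₂ (λ w y → w ++ y ∷ []) (factor-σ m k) (t-even-+ m k))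

factor-odd-odd : ∀ m k →
  factor (suc (m ℕ.* 2)) (suc (k ℕ.* 2)) ≡ next (t m) ∷ σ* (factor (suc m) k)
factor-odd-odd m k = cong₂ _∷_ (t-odd m) (factor-σ (suc m) k)

factor-odd-even-left : ∀ m k →
  t m ∷ factor (suc (m ℕ.* 2)) (k ℕ.* 2) ≡ σ* (factor m k) ++ t (m ℕ.+ k) ∷ []
factor-odd-even-left m k =
  trans (cong (_∷ factor (suc (m ℕ.* 2)) (k ℕ.* 2)) (sym (t-even m))) (factor-even-odd m k)

factor-odd-even-right : ∀ m k →
  factor (suc (m ℕ.* 2)) (k ℕ.* 2) ++ next (t (m ℕ.+ k)) ∷ []
    ≡ next (t m) ∷ σ* (factor (suc m) k)
factor-odd-even-right m k = begin
  factor (suc (m ℕ.* 2)) (k ℕ.* 2) ++ next (t (m ℕ.+ k)) ∷ []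
    ≡⟨ cong (λ y → factor (suc (m ℕ.* 2)) (k ℕ.* 2) ++ y ∷ []) (sym (t-odd-+ m k)) ⟩
  factor (suc (m ℕ.* 2)) (k ℕ.* 2) ++ t (suc (m ℕ.* 2 ℕ.+ k ℕ.* 2)) ∷ []
    ≡⟨ sym (factor-snoc (suc (m ℕ.* 2)) (k ℕ.* 2)) ⟩
  factor (suc (m ℕ.* 2)) (suc (k ℕ.* 2))
    ≡⟨ factor-odd-odd m k ⟩
  next (t m) ∷ σ* (factor (suc m) k) ∎

-- (3) Additive weights

weight : (Letter → ℤ) → List Letter → ℤ
weight f [] = 0ℤ
weight f (y ∷ w) = f y + weight f w

weight-++ : ∀ f w v → weight f (w ++ v) ≡ weight f w + weight f v
weight-++ f [] v = sym (ℤₚ.+-identityˡ (weight f v))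
weight-++ f (y ∷ w) v =
  trans (cong (_+_ (f y)) (weight-++ f w v)) (sym (ℤₚ.+-assoc (f y) (weight f w) (weight f v)))

weight-snoc : ∀ f w y → weight f (w ++ y ∷ []) ≡ weight f w + f y
weight-snoc f w y = trans (weight-++ f w (y ∷ [])) (cong (_+_ (weight f w)) (ℤₚ.+-identityʳ (f y)))

weight-σ* : ∀ f g → (∀ y → f y + f (next y) ≡ g y) → ∀ w → weight f (σ* w) ≡ weight g w
weight-σ* f g fg [] = refl
weight-σ* f g fg (y ∷ w) = begin
  weight f (σ* (y ∷ w))                       ≡⟨ cong (weight f) (σ*-cons y w) ⟩
  f y + (f (next y) + weight f (σ* w))       ≡⟨ sym (ℤₚ.+-assoc (f y) _ _) ⟩
  (f y + f (next y)) + weight f (σ* w)       ≡⟨ cong₂ _+_ (fg y) (weight-σ* f g fg w) ⟩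
  g y + weight g w                            ∎

δ : Letter → Letter → Letter → ℤ
δ p q y = + isLetter p y - + isLetter q y

diff≡weight : ∀ w p q → diff w p q ≡ weight (δ p q) w
diff≡weight [] p q = refl
diff≡weight (y ∷ w) p q = begin
  + (isLetter p y ℕ.+ ∣ w ∣[ p ]) - + (isLetter q y ℕ.+ ∣ w ∣[ q ])
    ≡⟨ cong₂ _-_ (ℤₚ.pos-+ (isLetter p y) _) (ℤₚ.pos-+ (isLetter q y) _) ⟩
  (+ isLetter p y + + ∣ w ∣[ p ]) - (+ isLetter q y + + ∣ w ∣[ q ])
    ≡⟨ regroup (+ isLetter p y) (+ ∣ w ∣[ p ]) (+ isLetter q y) (+ ∣ w ∣[ q ]) ⟩
  δ p q y + diff w p q
    ≡⟨ cong (_+_ (δ p q y)) (diff≡weight w p q) ⟩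
  δ p q y + weight (δ p q) w ∎
  where
  regroup : ∀ (a b c d : ℤ) → (a + b) - (c + d) ≡ (a - c) + (b - d)
  regroup = solve-∀

-- (4) The balance theorem

Small : ℤ → Set
Small e = (-1ℤ ≤ e) × (e ≤ 1ℤ)

Near : ℤ → ℤ → Set
Near U X = (X - 1ℤ ≤ U) × (U ≤ X + 1ℤ)

near : ∀ {U} X {e} → U ≡ X + e → Small e → Near U X
near X refl (-1≤e , e≤1) = ℤₚ.+-monoʳ-≤ X -1≤e , ℤₚ.+-monoʳ-≤ X e≤1

small-0 : Small 0ℤ
small-0 = -≤+ , +≤+ z≤n

isolate-left : ∀ a u x c → a + u ≡ x + c → u ≡ x + (c - a)
isolate-left a u x c eq = begin
  u               ≡⟨ expand a u ⟩
  (a + u) - a     ≡⟨ cong (_- a) eq ⟩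
  (x + c) - a     ≡⟨ reassoc x c a ⟩
  x + (c - a)     ∎
  where
  expand : ∀ (a u : ℤ) → u ≡ (a + u) - a
  expand = solve-∀
  reassoc : ∀ (x c a : ℤ) → (x + c) - a ≡ x + (c - a)
  reassoc = solve-∀

isolate-right : ∀ u c a x → u + c ≡ a + x → u ≡ x + (a - c)
isolate-right u c a x eq =
  isolate-left c u x a (trans (ℤₚ.+-comm c u) (trans eq (ℤₚ.+-comm a x)))

-- A pair of letter weights (f, g) for which f on factors of length n is
-- controlled by g on factors of length ⌊n/2⌋: f transfers to g along σ,
-- single letters weigh at most 1, and for every pair of boundary letters
-- one of the two possible corrections is at most 1.
record Admissible (f g : Letter → ℤ) : Set where
  field
    transfer       : ∀ y → f y + f (next y) ≡ g y
    letter-small   : ∀ y → Small (f y)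
    boundary-small : ∀ a c → Small (f c - f a) ⊎ Small (f (next a) - f (next c))

module Balance {f g : Letter → ℤ} (admissible : Admissible f g) where
  open Admissible admissible

  record Matched (k : ℕ) (u : List Letter) : Set where
    constructor matched-by
    field
      witness        : List Letter
      witness-factor : IsFactor k witness
      close          : Near (weight f u) (weight g witness)

  matched : ∀ (m : ℕ) {k : ℕ} {u : List Letter} (e : ℤ) →
    weight f u ≡ weight g (factor m k) + e → Small e → Matched k u
  matched m {k} e eq small =
    matched-by (factor m k) (factor-isFactor m k) (near (weight g (factor m k)) eq small)

  weight-σ*-snoc : ∀ x c → weight f (σ* x ++ c ∷ []) ≡ weight g x + f c
  weight-σ*-snoc x c = trans (weight-snoc f (σ* x) c) (cong (_+ f c) (weight-σ* f g transfer x))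

  weight-cons-σ* : ∀ b x → weight f (b ∷ σ* x) ≡ weight g x + f b
  weight-cons-σ* b x = trans (cong (_+_ (f b)) (weight-σ* f g transfer x)) (ℤₚ.+-comm (f b) _)

  even-even : ∀ m k → Matched k (factor (m ℕ.* 2) (k ℕ.* 2))
  even-even m k = matched m 0ℤ
    (trans (cong (weight f) (factor-σ m k))
      (trans (weight-σ* f g transfer (factor m k)) (sym (ℤₚ.+-identityʳ _))))
    small-0

  even-odd : ∀ m k → Matched k (factor (m ℕ.* 2) (suc (k ℕ.* 2)))
  even-odd m k = matched m (f (t (m ℕ.+ k)))
    (trans (cong (weight f) (factor-even-odd m k)) (weight-σ*-snoc (factor m k) _))
    (letter-small _)

  odd-odd : ∀ m k → Matched k (factor (suc (m ℕ.* 2)) (suc (k ℕ.* 2)))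
  odd-odd m k = matched (suc m) (f (next (t m)))
    (trans (cong (weight f) (factor-odd-odd m k)) (weight-cons-σ* _ (factor (suc m) k)))
    (letter-small _)

  -- The only case needing a choice: complete u on whichever side keeps the
  -- boundary correction small.
  odd-even : ∀ m k → Matched k (factor (suc (m ℕ.* 2)) (k ℕ.* 2))
  odd-even m k with boundary-small (t m) (t (m ℕ.+ k))
  ... | inj₁ small = matched m _
    (isolate-left (f (t m)) (weight f u) (weight g (factor m k)) (f (t (m ℕ.+ k))) left) small
    where
    u : List Letter
    u = factor (suc (m ℕ.* 2)) (k ℕ.* 2)
    left : f (t m) + weight f u ≡ weight g (factor m k) + f (t (m ℕ.+ k))
    left = trans (cong (weight f) (factor-odd-even-left m k)) (weight-σ*-snoc (factor m k) _)
  ... | inj₂ small = matched (suc m) _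
    (isolate-right (weight f u) (f (next (t (m ℕ.+ k)))) (f (next (t m)))
      (weight g (factor (suc m) k)) right) small
    where
    u : List Letter
    u = factor (suc (m ℕ.* 2)) (k ℕ.* 2)
    right : weight f u + f (next (t (m ℕ.+ k))) ≡ f (next (t m)) + weight g (factor (suc m) k)
    right = begin
      weight f u + f (next (t (m ℕ.+ k)))          ≡⟨ sym (weight-snoc f u _) ⟩
      weight f (u ++ next (t (m ℕ.+ k)) ∷ [])      ≡⟨ cong (weight f) (factor-odd-even-right m k) ⟩
      f (next (t m)) + weight f (σ* (factor (suc m) k))
        ≡⟨ cong (_+_ (f (next (t m)))) (weight-σ* f g transfer (factor (suc m) k)) ⟩
      f (next (t m)) + weight g (factor (suc m) k) ∎

  by-parity : ∀ r s m k → r < 2 → s < 2 →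
    Matched k (factor (r ℕ.+ m ℕ.* 2) (s ℕ.+ k ℕ.* 2))
  by-parity 0 0 m k _ _ = even-even m k
  by-parity 0 1 m k _ _ = even-odd m k
  by-parity 1 0 m k _ _ = odd-even m k
  by-parity 1 1 m k _ _ = odd-odd m k
  by-parity (suc (suc _)) _ _ _ (s≤s (s≤s ())) _
  by-parity _ (suc (suc _)) _ _ _ (s≤s (s≤s ()))

  balance : ∀ i n → Matched (n / 2) (factor i n)
  balance i n = subst (Matched (n / 2))
    (sym (cong₂ factor (m≡m%n+[m/n]*n i 2) (m≡m%n+[m/n]*n n 2)))
    (by-parity (i % 2) (n % 2) (i / 2) (n / 2) (m%n<n i 2) (m%n<n n 2))

balance-diff : ∀ {p q p' q'} → Admissible (δ p q) (δ p' q') → ∀ i n →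
  ∃ λ x → IsFactor (n / 2) x × Near (diff (factorAt i n) p q) (diff x p' q')
balance-diff {p} {q} {p'} {q'} admissible i n with Balance.balance admissible i n
... | Balance.matched-by x x-factor close =
  x , x-factor , subst₂ Near (sym u-weight) (sym (diff≡weight x p' q')) close
  where
  u-weight : diff (factorAt i n) p q ≡ weight (δ p q) (factor i n)
  u-weight = trans (diff≡weight (factorAt i n) p q) (cong (weight (δ p q)) (factorAt≡factor i n))

-- (5) The three instances

all-letters? : {P : Letter → Set} → (∀ y → Dec (P y)) → Dec (∀ y → P y)
all-letters? P? with P? a0 | P? a1 | P? a2
... | yes p0 | yes p1 | yes p2 = yes λ { a0 → p0 ; a1 → p1 ; a2 → p2 }
... | no ¬p0 | _      | _      = no λ all → ¬p0 (all a0)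
... | yes _  | no ¬p1 | _      = no λ all → ¬p1 (all a1)
... | yes _  | yes _  | no ¬p2 = no λ all → ¬p2 (all a2)

small? : ∀ e → Dec (Small e)
small? e = (-1ℤ ℤₚ.≤? e) ×-dec (e ℤₚ.≤? 1ℤ)

-- Admissibility of concrete weights is a finite check, run by evaluation.
admissible-by-computation : ∀ f g →
  True (all-letters? λ y → f y + f (next y) ℤₚ.≟ g y) →
  True (all-letters? λ y → small? (f y)) →
  True (all-letters? λ a → all-letters? λ c →
          small? (f c - f a) ⊎-dec small? (f (next a) - f (next c))) →
  Admissible f g
admissible-by-computation f g tr ls bs = record
  { transfer       = toWitness tr
  ; letter-small   = toWitness ls
  ; boundary-small = λ a c → toWitness bs a c
  }

lemma4 : (n : ℕ) → n ≥ 1 → (u : List Letter) → IsFactor n u →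
    (∃ λ x → IsFactor (n / 2) x ×
      (diff x a1 a0 - 1ℤ ≤ diff u a2 a0) × (diff u a2 a0 ≤ diff x a1 a0 + 1ℤ))
    × (∃ λ y → IsFactor (n / 2) y ×
      (diff y a1 a2 - 1ℤ ≤ diff u a1 a0) × (diff u a1 a0 ≤ diff y a1 a2 + 1ℤ))
    × (∃ λ z → IsFactor (n / 2) z ×
      (diff z a0 a2 - 1ℤ ≤ diff u a1 a2) × (diff u a1 a2 ≤ diff z a0 a2 + 1ℤ))
lemma4 n _ u (i , refl) =
    balance-diff (admissible-by-computation (δ a2 a0) (δ a1 a0) _ _ _) i n
  , balance-diff (admissible-by-computation (δ a1 a0) (δ a1 a2) _ _ _) i n
  , balance-diff (admissible-by-computation (δ a1 a2) (δ a0 a2) _ _ _) i n
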